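{- Let $G$ be a connected graph with girth at least $5$, with $G\neq K_1$ and $G\neq K_2$. If $G$ has $n$ vertices, then $meg(G)\leq n-1$.
   Context: All graphs are finite and simple. The girth is the length of a shortest cycle (infinite for acyclic graphs). A pair of vertices $u,v$ (or any vertex set containing them) monitors an edge $e$ if $e$ lies on every shortest $u$–$v$ path. A monitoring edge-geodetic set (MEG-set) of $G$ is a set $M\subseteq V(G)$ such that every edge of $G$ is monitored by some pair of vertices of $M$; $meg(G)$ is the minimum size of an MEG-set. -}

module Defs where

open import Data.Nat using (ℕ; zero; suc; _≤_; _∸_)
open import Data.Fin using (Fin)
open import Data.Fin.Subset using (Subset; _∈_; ∣_∣)
open import Data.Bool using (Bool; true; false)
open import Data.List using (List; []; _∷_)
open import Data.List.Relation.Unary.Unique.Propositional using (Unique)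
open import Data.Product using (_×_; Σ; ∃)
open import Data.Sum using (_⊎_)
open import Relation.Binary.PropositionalEquality using (_≡_; _≢_)

record Graph (n : ℕ) : Set where
  field
    adj     : Fin n → Fin n → Bool
    symm    : ∀ u v → adj u v ≡ adj v u
    irrefl  : ∀ u → adj u u ≡ false

module _ {n : ℕ} (G : Graph n) where
  open Graph G

  Adj : Fin n → Fin n → Set
  Adj u v = adj u v ≡ true

  data Walk : Fin n → Fin n → Set where
    []  : ∀ {u} → Walk u u
    _∷_ : ∀ {u w v} → Adj u w → Walk w v → Walk u v

  len : ∀ {u v} → Walk u v → ℕ
  len []      = 0
  len (_ ∷ W) = suc (len W)

  verts : ∀ {u v} → Walk u v → List (Fin n)
  verts {u} []      = u ∷ []
  verts {u} (_ ∷ W) = u ∷ verts W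

  IsPath : ∀ {u v} → Walk u v → Set
  IsPath W = Unique (verts W)

  data EdgeOn (a b : Fin n) : ∀ {u v} → Walk u v → Set where
    here  : ∀ {u w v} (e : Adj u w) (W : Walk w v) →
            (u ≡ a × w ≡ b) ⊎ (u ≡ b × w ≡ a) → EdgeOn a b (e ∷ W)
    there : ∀ {u w v} (e : Adj u w) {W : Walk w v} →
            EdgeOn a b W → EdgeOn a b (e ∷ W)

  IsShortestPath : ∀ {u v} → Walk u v → Set
  IsShortestPath {u} {v} W = IsPath W × (∀ (W′ : Walk u v) → IsPath W′ → len W ≤ len W′)

  Monitors : Fin n → Fin n → Fin n → Fin n → Set
  Monitors u v a b = ∀ (W : Walk u v) → IsShortestPath W → EdgeOn a b W

  IsMEG : Subset n → Set
  IsMEG M = ∀ a b → Adj a b →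
    Σ (Fin n) λ u → Σ (Fin n) λ v → u ∈ M × v ∈ M × Monitors u v a b

  -- a cycle: closed walk of length ≥ 3 whose vertices (the repeated endpoint counted once) are distinct
  IsCycle : ∀ {u} → Walk u u → Set
  IsCycle [] = 3 ≤ 0
  IsCycle (_ ∷ W) = 3 ≤ suc (len W) × Unique (verts W)

  -- girth ≥ k: every cycle has length ≥ k (acyclic graphs have infinite girth)
  GirthAtLeast : ℕ → Set
  GirthAtLeast k = ∀ u (C : Walk u u) → IsCycle C → k ≤ len C

  Connected : Set
  Connected = ∀ u v → Walk u v

  IsK1 : Set
  IsK1 = n ≡ 1

  IsK2 : Set
  IsK2 = n ≡ 2 × (∀ u v → u ≢ v → Adj u v)

{-# OPTIONS --safe #-}
module Submission where

-- A connected graph on at least three vertices has a vertex v with two distinct neighbours.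
-- Then every vertex except v already monitors all edges: an edge away from v is the unique
-- shortest path between its endpoints, and an edge va is monitored by a and another
-- neighbour c of v, because girth ≥ 5 makes a–v–c the unique shortest a–c path
-- (a shorter one would close a triangle, another one of length 2 a 4-cycle).

open import Defs
open import Data.Nat using (ℕ; _≤_; _∸_; zero; suc; _+_; s≤s; z≤n)
open import Data.Nat.Properties using (≤-reflexive)
open import Data.Fin using (Fin; _≟_) renaming (zero to fz; suc to fs)
open import Data.Fin.Subset using (Subset; ∣_∣; _∈_; ∁; ⁅_⁆)
open import Data.Fin.Subset.Properties using (x∉p⇒x∈∁p; x≢y⇒x∉⁅y⁆; ∣∁p∣≡n∸∣p∣; ∣⁅x⁆∣≡1)
open import Data.Product using (_×_; Σ; _,_)
open import Data.Sum using (_⊎_; inj₁; inj₂; swap; map₂)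
open import Data.Empty using (⊥; ⊥-elim)
open import Data.Vec using ([])
open import Data.List.Relation.Unary.All using ([]; _∷_)
open import Data.List.Relation.Unary.AllPairs using ([]; _∷_)
open import Relation.Nullary using (¬_; yes; no)
open import Relation.Binary.PropositionalEquality using (_≡_; _≢_; refl; sym; trans; cong; ≢-sym)

∣∁⁅x⁆∣≡n∸1 : ∀ {n} (x : Fin n) → ∣ ∁ ⁅ x ⁆ ∣ ≡ n ∸ 1
∣∁⁅x⁆∣≡n∸1 {n} x = trans (∣∁p∣≡n∸∣p∣ ⁅ x ⁆) (cong (n ∸_) (∣⁅x⁆∣≡1 x))

x≢y⇒x∈∁⁅y⁆ : ∀ {n} {x y : Fin n} → x ≢ y → x ∈ ∁ ⁅ y ⁆
x≢y⇒x∈∁⁅y⁆ x≢y = x∉p⇒x∈∁p (x≢y⇒x∉⁅y⁆ x≢y)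

module _ {n : ℕ} (G : Graph n) where
  open Graph G

  Adj⇒≢ : ∀ {a b} → Adj G a b → a ≢ b
  Adj⇒≢ {a} e refl with trans (sym e) (irrefl a)
  ... | ()

  Adj-sym : ∀ {a b} → Adj G a b → Adj G b a
  Adj-sym {a} {b} e = trans (symm b a) e

  EdgeOn-sym : ∀ {a b u v} {W : Walk G u v} → EdgeOn G a b W → EdgeOn G b a W
  EdgeOn-sym (here e W ends) = here e W (swap ends)
  EdgeOn-sym (there e on)    = there e (EdgeOn-sym on)

  record Cherry : Set where
    constructor cherry
    field
      {centre left right} : Fin n
      centre-left  : Adj G centre left
      centre-right : Adj G centre right
      left≢right   : left ≢ right

    another-neighbour : ∀ b → Σ (Fin n) λ c → Adj G centre c × b ≢ c
    another-neighbour b with b ≟ left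
    ... | yes refl = right , centre-right , left≢right
    ... | no b≢l   = left , centre-left , b≢l

  cherry-or-endpoint : ∀ {u w t} → Adj G u w → Walk G w t → Cherry ⊎ (t ≡ u ⊎ t ≡ w)
  cherry-or-endpoint e [] = inj₂ (inj₂ refl)
  cherry-or-endpoint {u} e (_∷_ {w = x} e′ W) with x ≟ u
  ... | no x≢u   = inj₁ (cherry (Adj-sym e) e′ (≢-sym x≢u))
  ... | yes refl = map₂ swap (cherry-or-endpoint e′ W)

  cherry-or-adjacent : ∀ {s t} → Walk G s t → s ≢ t → Cherry ⊎ Adj G s t
  cherry-or-adjacent [] s≢t = ⊥-elim (s≢t refl)
  cherry-or-adjacent (e ∷ W) s≢t with cherry-or-endpoint e W
  ... | inj₁ ch            = inj₁ ch
  ... | inj₂ (inj₁ refl) = ⊥-elim (s≢t refl)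
  ... | inj₂ (inj₂ refl) = inj₂ e

  module _ (girth≥5 : GirthAtLeast G 5) where

    triangle-free : ∀ {a b c} → Adj G a b → Adj G b c → Adj G c a → ⊥
    triangle-free {a} ab bc ca
      with girth≥5 a (ab ∷ bc ∷ ca ∷ [])
             ( s≤s (s≤s (s≤s z≤n))
             , (Adj⇒≢ bc ∷ ≢-sym (Adj⇒≢ ab) ∷ []) ∷ (Adj⇒≢ ca ∷ []) ∷ [] ∷ [])
    ... | s≤s (s≤s (s≤s ()))

    square-free : ∀ {a b c d} → Adj G a b → Adj G b c → Adj G c d → Adj G d a →
                  a ≢ c → b ≢ d → ⊥
    square-free {a} ab bc cd da a≢c b≢d
      with girth≥5 a (ab ∷ bc ∷ cd ∷ da ∷ [])
             ( s≤s (s≤s (s≤s z≤n))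
             , (Adj⇒≢ bc ∷ b≢d ∷ ≢-sym (Adj⇒≢ ab) ∷ [])
             ∷ (Adj⇒≢ cd ∷ ≢-sym a≢c ∷ [])
             ∷ (Adj⇒≢ da ∷ [])
             ∷ [] ∷ [])
    ... | s≤s (s≤s (s≤s (s≤s ())))

    common-neighbour-unique : ∀ {a c x y} → a ≢ c →
      Adj G a x → Adj G x c → Adj G a y → Adj G y c → x ≡ y
    common-neighbour-unique a≢c ax xc ay yc with _ ≟ _
    ... | yes x≡y = x≡y
    ... | no x≢y  = ⊥-elim (square-free ax xc (Adj-sym yc) (Adj-sym ay) a≢c x≢y)

    cherry-monitors-edge : ∀ {v a c} → Adj G v a → Adj G v c → a ≢ c → Monitors G a c a v
    cherry-monitors-edge va vc a≢c [] _ = ⊥-elim (a≢c refl)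
    cherry-monitors-edge va vc a≢c (ac ∷ []) _ = ⊥-elim (triangle-free va ac (Adj-sym vc))
    cherry-monitors-edge va vc a≢c (ax ∷ xc ∷ []) _
      with common-neighbour-unique a≢c ax xc (Adj-sym va) vc
    ... | refl = here ax _ (inj₁ (refl , refl))
    cherry-monitors-edge va vc a≢c (_ ∷ _ ∷ _ ∷ _) (_ , shortest)
      with shortest (Adj-sym va ∷ vc ∷ [])
             ((≢-sym (Adj⇒≢ va) ∷ a≢c ∷ []) ∷ (Adj⇒≢ vc ∷ []) ∷ [] ∷ [])
    ... | s≤s (s≤s ())

  edge-monitors-itself : ∀ {a b} → Adj G a b → Monitors G a b a b
  edge-monitors-itself ab [] _ = ⊥-elim (Adj⇒≢ ab refl)
  edge-monitors-itself ab (ab′ ∷ []) _ = here ab′ [] (inj₁ (refl , refl))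
  edge-monitors-itself ab (_ ∷ _ ∷ _) (_ , shortest)
    with shortest (ab ∷ []) ((Adj⇒≢ ab ∷ []) ∷ [] ∷ [])
  ... | s≤s ()

  ∁centre-isMEG : GirthAtLeast G 5 → (ch : Cherry) → IsMEG G (∁ ⁅ Cherry.centre ch ⁆)
  ∁centre-isMEG girth≥5 ch a b ab with a ≟ v | b ≟ v
    where v = Cherry.centre ch
  ... | yes refl | yes refl = ⊥-elim (Adj⇒≢ ab refl)
  ... | yes refl | no b≢v with Cherry.another-neighbour ch b
  ...   | c , vc , b≢c = b , c , x≢y⇒x∈∁⁅y⁆ b≢v , x≢y⇒x∈∁⁅y⁆ (≢-sym (Adj⇒≢ vc)) ,
          λ W sp → EdgeOn-sym (cherry-monitors-edge girth≥5 ab vc b≢c W sp)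
  ∁centre-isMEG girth≥5 ch a b ab | no a≢v | yes refl with Cherry.another-neighbour ch a
  ...   | c , vc , a≢c = a , c , x≢y⇒x∈∁⁅y⁆ a≢v , x≢y⇒x∈∁⁅y⁆ (≢-sym (Adj⇒≢ vc)) ,
          cherry-monitors-edge girth≥5 (Adj-sym ab) vc a≢c
  ∁centre-isMEG girth≥5 ch a b ab | no a≢v | no b≢v =
    a , b , x≢y⇒x∈∁⁅y⁆ a≢v , x≢y⇒x∈∁⁅y⁆ b≢v , edge-monitors-itself ab

connected⇒K2 : (G : Graph 2) → Connected G → IsK2 G
connected⇒K2 G connected = refl , adjacent
  where
  edge : Adj G fz (fs fz)
  edge with connected fz (fs fz)
  ... | _∷_ {w = fz}    e _ = ⊥-elim (Adj⇒≢ G e refl)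
  ... | _∷_ {w = fs fz} e _ = e
  adjacent : ∀ u v → u ≢ v → Adj G u v
  adjacent fz      fz      u≢v = ⊥-elim (u≢v refl)
  adjacent fz      (fs fz) _   = edge
  adjacent (fs fz) fz      _   = Adj-sym G edge
  adjacent (fs fz) (fs fz) u≢v = ⊥-elim (u≢v refl)

connected⇒cherry : ∀ {k} (G : Graph (3 + k)) → Connected G → Cherry G
connected⇒cherry G connected
  with cherry-or-adjacent G (connected fz (fs fz)) (λ ())
     | cherry-or-adjacent G (connected fz (fs (fs fz))) (λ ())
... | inj₁ ch | _       = ch
... | inj₂ _  | inj₁ ch = ch
... | inj₂ e₁ | inj₂ e₂ = cherry e₁ e₂ (λ ())

mainTheorem20 : ∀ (n : ℕ) (G : Graph n) → Connected G → GirthAtLeast G 5 →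
    ¬ IsK1 G → ¬ IsK2 G →
    Σ (Subset n) λ M → IsMEG G M × ∣ M ∣ ≤ n ∸ 1
mainTheorem20 zero G _ _ _ _ = [] , (λ ()) , z≤n
mainTheorem20 (suc zero) G _ _ ¬K1 _ = ⊥-elim (¬K1 refl)
mainTheorem20 (suc (suc zero)) G connected _ _ ¬K2 = ⊥-elim (¬K2 (connected⇒K2 G connected))
mainTheorem20 (suc (suc (suc _))) G connected girth≥5 _ _ =
  ∁ ⁅ centre ⁆ , ∁centre-isMEG G girth≥5 ch , ≤-reflexive (∣∁⁅x⁆∣≡n∸1 centre)
  where
  ch : Cherry G
  ch = connected⇒cherry G connected
  open Cherry ch using (centre)
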